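{- Let $n\ge4$ be even and $x\in Y_1$. For $2\le j\le n-2$, $\tau_{\mathbf m}(\nu_{j-1}(x))\subseteq\tau_{\mathbf m}(\nu_j(x))$ if and only if $s_j\in\tau_{\mathbf m}(x)$ and $s_{j+1}\notin\tau_{\mathbf m}(x)$. Moreover, $\tau_{\mathbf m}(\nu_{n-2}(x))\subseteq\tau_{\mathbf m}(\nu_{n-1}(x))$ if and only if $s_{n-1}\in\tau_{\mathbf m}(x)$.
   Context: $S_n$ symmetric group, $s_i=(i,i+1)$, $S=\{s_1,\dots,s_{n-1}\}$, $\ell$ length, $\mathcal F_n$ fixed-point-free involutions of $S_n$ with Bruhat order $\le$ the weakest partial order with $z\le tzt$ for transpositions $t$ with $\ell(z)\le\ell(tzt)$; $\tau_{\mathbf m}(z)=\{s\in S:szs\le z\}$. View $S_{n-2}\subset S_n$ fixing $n-1,n$; $w_0$ longest element of $S_n$; $\rho_n(z)=w_0zs_{n-1}w_0$ for $z\in\mathcal F_{n-2}$; $Y_1=\rho_n(\mathcal F_{n-2})$; $\sigma_j=s_j\cdots s_1$; $\nu_j(x)=\sigma_jx\sigma_j^{ -1}$ for $x\in Y_1$ ($\nu_1=\mathrm{id}$). -}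

module Defs where

open import Data.Nat using (ℕ; zero; suc; _+_; _≤_; _<_; _<ᵇ_; _<?_)
open import Data.Nat.Properties using (<-trans; n<1+n)
open import Data.Bool using (Bool; true; false; if_then_else_; _∧_)
open import Data.Fin using (Fin; toℕ; fromℕ<; opposite; _↑ˡ_; _↑ʳ_; _≟_)
open import Data.Fin.Base using () renaming (zero to fz; suc to fs)
open import Data.Vec using (Vec; []; _∷_; lookup; tabulate; map; sum; _++_)
open import Data.Product using (Σ; _×_; _,_)
open import Relation.Nullary using (¬_; yes; no; does)
open import Relation.Binary.PropositionalEquality using (_≡_)
open import Relation.Binary.Construct.Closure.ReflexiveTransitive using (Star)

-- Permutations of {1,…,n} in one-line notation: position k ↦ value (0-indexed Fin n).
Perm : ℕ → Set
Perm n = Vec (Fin n) n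

idP : ∀ {n} → Perm n
idP = tabulate (λ k → k)

_∘P_ : ∀ {n} → Perm n → Perm n → Perm n
u ∘P v = tabulate (λ k → lookup u (lookup v k))

swap : ∀ {n} → Fin n → Fin n → Perm n
swap a b = tabulate (λ k → if does (k ≟ a) then b else (if does (k ≟ b) then a else k))

-- simple transposition s_i = (i, i+1) in 1-indexed terms, for 1 ≤ i ≤ n-1
-- (identity outside that range; never used there)
sAdj : ∀ {n} → ℕ → Perm n
sAdj {n} zero = idP
sAdj {n} (suc i) with suc i <? n
... | yes p = swap (fromℕ< (<-trans (n<1+n i) p)) (fromℕ< p)
... | no _ = idP

w0 : ∀ {n} → Perm n
w0 = tabulate opposite

invPair : ∀ {n} → Fin n → Fin n → Fin n → Fin n → ℕ
invPair i j a b = if (toℕ i <ᵇ toℕ j) ∧ (toℕ b <ᵇ toℕ a) then 1 else 0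

len : ∀ {n} → Perm n → ℕ
len {n} w = sum (tabulate (λ i → sum (tabulate (λ j → invPair i j (lookup w i) (lookup w j)))))

FPF : ∀ {n} → Perm n → Set
FPF z = ∀ i → (lookup z (lookup z i) ≡ i) × ¬ (lookup z i ≡ i)

data BStep {n} : Perm n → Perm n → Set where
  step : ∀ (a b : Fin n) (z : Perm n) → ¬ (a ≡ b) →
         len z ≤ len (swap a b ∘P (z ∘P swap a b)) →
         BStep z (swap a b ∘P (z ∘P swap a b))

_≤B_ : ∀ {n} → Perm n → Perm n → Set
_≤B_ = Star BStep

InTau : ∀ {n} → Perm n → ℕ → Set
InTau {n} z i = (1 ≤ i) × (i < n) × ((sAdj i ∘P (z ∘P sAdj i)) ≤B z)

TauSub : ∀ {n} → Perm n → Perm n → Set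
TauSub a b = ∀ i → InTau a i → InTau b i

embed : ∀ {m} → Perm m → Perm (m + 2)
embed {m} z = map (λ i → i ↑ˡ 2) z ++ ((m ↑ʳ fz) ∷ (m ↑ʳ fs fz) ∷ [])

rho : ∀ {m} → Perm m → Perm (m + 2)
rho {m} z = w0 ∘P (embed z ∘P (sAdj (suc m) ∘P w0))

InY1 : ∀ m → Perm (m + 2) → Set
InY1 m x = Σ (Perm m) (λ z → FPF z × (x ≡ rho z))

sigma : ∀ {n} → ℕ → Perm n
sigma zero = idP
sigma (suc j) = sAdj (suc j) ∘P sigma j

sigmaInv : ∀ {n} → ℕ → Perm n
sigmaInv zero = idP
sigmaInv (suc j) = sigmaInv j ∘P sAdj (suc j)

nu : ∀ {n} → ℕ → Perm n → Perm n
nu j x = sigma j ∘P (x ∘P sigmaInv j)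

{-# OPTIONS --safe #-}
-- For a fixed-point-free involution w, s_i ∈ τ(w) exactly when w(i+1) < w(i) or w(i) = i+1:
-- otherwise conjugating w by s_i keeps every inversion and creates a new one, while the Bruhat
-- order never lowers the length. An element x of Y₁ is a fixed-point-free involution with
-- x(1) = 2, and ν_j x relabels positions and values 1, …, j+1 by the cycle σ_j, which is
-- increasing away from 1. Hence s_j ∈ τ(ν_j x) and s_(j+1) ∉ τ(ν_j x) since (ν_j x)(j+1) = 1;
-- for j ≥ 2, s_1 ∈ τ(ν_j x) iff x(3) ≤ j+1; for 2 ≤ i < j, s_i ∈ τ(ν_j x) iff s_(i+1) ∈ τ(x);
-- and for i > j+1, s_i ∈ τ(ν_j x) iff s_i ∈ τ(x). Comparing ν_(j-1) x with ν_j x position by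
-- position gives the theorem.
module Submission where

open import Defs
open import Data.Bool using (Bool; true; false; if_then_else_; _∧_; T)
open import Data.Empty using (⊥-elim)
open import Data.Fin using (Fin; toℕ; fromℕ<; opposite; _↑ˡ_; _↑ʳ_; _≟_)
open import Data.Fin.Base using () renaming (zero to fz; suc to fs)
open import Data.Fin.Permutation using (permutation)
open import Data.Fin.Properties
  using (toℕ-injective; toℕ-fromℕ<; toℕ<n; toℕ-↑ˡ; toℕ-↑ʳ; opposite-prop; opposite-involutive)
open import Data.Nat using (ℕ; zero; suc; _+_; _≤_; _<_; _∸_; _<?_; z≤n; s≤s; s≤s⁻¹; z<s)
open import Data.Nat.Divisibility using (_∣_)
open import Data.Nat.Properties
  using ( ≤-refl; ≤-trans; ≤-reflexive; ≤-antisym; ≤-<-trans; <-trans; <-irrefl; <-asym; <-cmp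
        ; ≤∧≢⇒<; ≮⇒≥; <⇒≤; <⇒≢; >⇒≢; n<1+n; n≤1+n; m≤n⇒m≤1+n; m≤n⇒m<n∨m≡n; n≢0⇒n>0; n≮0; 0≢1+n
        ; m<m+n; <ᵇ⇒<; <⇒<ᵇ; +-comm; +-identityʳ; +-mono-≤; +-mono-<-≤; +-mono-≤-<; m+n∸n≡m
        ; +-0-commutativeMonoid)
open import Data.Product using (_×_; _,_; proj₁; proj₂; ∃₂)
open import Data.Sum using (_⊎_; inj₁; inj₂)
open import Data.Vec using (Vec; []; _∷_; _++_; lookup; map; tabulate; sum)
open import Data.Vec.Properties using (lookup∘tabulate; tabulate∘lookup; tabulate-cong)
open import Function using (_∘_; flip)
open import Function.Bundles using (_⇔_; mk⇔; module Equivalence)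
open Equivalence using (to; from)
open import Function.Construct.Composition using (_⇔-∘_)
open import Relation.Binary.Construct.Closure.ReflexiveTransitive using (ε; _◅_)
open import Relation.Binary.Definitions using (tri<; tri≈; tri>)
open import Relation.Binary.PropositionalEquality
open import Relation.Nullary using (¬_; yes; no; does)
open import Relation.Nullary.Decidable using (dec-true; dec-false)
import Algebra.Properties.CommutativeMonoid.Sum as CommutativeMonoidSum

module ℕSum = CommutativeMonoidSum +-0-commutativeMonoid

sum-tabulate : ∀ {n} (f : Fin n → ℕ) → sum (tabulate f) ≡ ℕSum.sum f
sum-tabulate {zero}  f = refl
sum-tabulate {suc n} f = cong (f fz +_) (sum-tabulate (f ∘ fs))

sum-tabulate-involution : ∀ {n} (t : Fin n → Fin n) → (∀ k → t (t k) ≡ k) → (f : Fin n → ℕ) →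
                          sum (tabulate f) ≡ sum (tabulate (f ∘ t))
sum-tabulate-involution t t-inv f = begin
  sum (tabulate f)        ≡⟨ sum-tabulate f ⟩
  ℕSum.sum f              ≡⟨ ℕSum.sum-permute f (permutation t t t-inv t-inv) ⟩
  ℕSum.sum (f ∘ t)        ≡⟨ sum-tabulate (f ∘ t) ⟨
  sum (tabulate (f ∘ t))  ∎
  where open ≡-Reasoning

sum-tabulate-mono-≤ : ∀ {n} {f g : Fin n → ℕ} → (∀ k → f k ≤ g k) → sum (tabulate f) ≤ sum (tabulate g)
sum-tabulate-mono-≤ {zero}  f≤g = z≤n
sum-tabulate-mono-≤ {suc n} f≤g = +-mono-≤ (f≤g fz) (sum-tabulate-mono-≤ (f≤g ∘ fs))

sum-tabulate-mono-< : ∀ {n} {f g : Fin n → ℕ} → (∀ k → f k ≤ g k) → ∀ k → f k < g k →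
                      sum (tabulate f) < sum (tabulate g)
sum-tabulate-mono-< f≤g fz     fk<gk = +-mono-<-≤ fk<gk (sum-tabulate-mono-≤ (f≤g ∘ fs))
sum-tabulate-mono-< f≤g (fs k) fk<gk = +-mono-≤-< (f≤g fz) (sum-tabulate-mono-< (f≤g ∘ fs) k fk<gk)

vec-ext : ∀ {n} {A : Set} {u v : Vec A n} → (∀ k → lookup u k ≡ lookup v k) → u ≡ v
vec-ext {u = u} {v} eq = trans (sym (tabulate∘lookup u)) (trans (tabulate-cong eq) (tabulate∘lookup v))

lookup-idP : ∀ {n} (k : Fin n) → lookup idP k ≡ k
lookup-idP = lookup∘tabulate (λ k → k)

lookup-∘P : ∀ {n} (u v : Perm n) k → lookup (u ∘P v) k ≡ lookup u (lookup v k)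
lookup-∘P u v = lookup∘tabulate (λ k → lookup u (lookup v k))

∘P-assoc : ∀ {n} (u v w : Perm n) → (u ∘P v) ∘P w ≡ u ∘P (v ∘P w)
∘P-assoc u v w = vec-ext λ k → begin
  lookup ((u ∘P v) ∘P w) k          ≡⟨ lookup-∘P (u ∘P v) w k ⟩
  lookup (u ∘P v) (lookup w k)      ≡⟨ lookup-∘P u v (lookup w k) ⟩
  lookup u (lookup v (lookup w k))  ≡⟨ cong (lookup u) (lookup-∘P v w k) ⟨
  lookup u (lookup (v ∘P w) k)      ≡⟨ lookup-∘P u (v ∘P w) k ⟨
  lookup (u ∘P (v ∘P w)) k          ∎
  where open ≡-Reasoning

module _ {n} (a b : Fin n) where

  private
    lookup-swap : ∀ k → lookup (swap a b) k ≡ (if does (k ≟ a) then b else (if does (k ≟ b) then a else k))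
    lookup-swap = lookup∘tabulate _

  lookup-swap-left : lookup (swap a b) a ≡ b
  lookup-swap-left rewrite lookup-swap a | dec-true (a ≟ a) refl = refl

  lookup-swap-right : lookup (swap a b) b ≡ a
  lookup-swap-right rewrite lookup-swap b with b ≟ a
  ... | yes b≡a = b≡a
  ... | no  _   rewrite dec-true (b ≟ b) refl = refl

  lookup-swap-other : ∀ {k} → k ≢ a → k ≢ b → lookup (swap a b) k ≡ k
  lookup-swap-other {k} k≢a k≢b rewrite lookup-swap k | dec-false (k ≟ a) k≢a | dec-false (k ≟ b) k≢b = refl

  lookup-swap-involutive : ∀ k → lookup (swap a b) (lookup (swap a b) k) ≡ k
  lookup-swap-involutive k with k ≟ a | k ≟ b
  ... | yes refl | _        = trans (cong (lookup (swap a b)) lookup-swap-left) lookup-swap-right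
  ... | no  _    | yes refl = trans (cong (lookup (swap a b)) lookup-swap-right) lookup-swap-left
  ... | no  k≢a  | no  k≢b  =
    trans (cong (lookup (swap a b)) (lookup-swap-other k≢a k≢b)) (lookup-swap-other k≢a k≢b)

swapConj : ∀ {n} → Fin n → Fin n → Perm n → Perm n
swapConj a b w = swap a b ∘P (w ∘P swap a b)

lookup-swapConj : ∀ {n} (a b : Fin n) (w : Perm n) k →
                  lookup (swapConj a b w) k ≡ lookup (swap a b) (lookup w (lookup (swap a b) k))
lookup-swapConj a b w k =
  trans (lookup-∘P (swap a b) (w ∘P swap a b) k) (cong (lookup (swap a b)) (lookup-∘P w (swap a b) k))

swapConj-involutive : ∀ {n} (a b : Fin n) (w : Perm n) → swapConj a b (swapConj a b w) ≡ w
swapConj-involutive a b w = vec-ext λ k → begin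
  lookup (swapConj a b (swapConj a b w)) k                 ≡⟨ lookup-swapConj a b (swapConj a b w) k ⟩
  t (lookup (swapConj a b w) (t k))                        ≡⟨ cong t (lookup-swapConj a b w (t k)) ⟩
  t (t (lookup w (t (t k))))                               ≡⟨ lookup-swap-involutive a b _ ⟩
  lookup w (t (t k))                                       ≡⟨ cong (lookup w) (lookup-swap-involutive a b k) ⟩
  lookup w k                                               ∎
  where
  open ≡-Reasoning
  t = lookup (swap a b)

FPF-conj : ∀ {n} {w : Perm n} (u v : Perm n) →
           (∀ k → lookup u (lookup v k) ≡ k) → (∀ k → lookup v (lookup u k) ≡ k) →
           FPF w → FPF (u ∘P (w ∘P v))
FPF-conj {w = w} u v uv vu w-fpf k = involutive , fixedPointFree
  where
  U = lookup u
  V = lookup v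
  W = lookup w
  conj : ∀ l → lookup (u ∘P (w ∘P v)) l ≡ U (W (V l))
  conj l = trans (lookup-∘P u (w ∘P v) l) (cong U (lookup-∘P w v l))
  involutive : lookup (u ∘P (w ∘P v)) (lookup (u ∘P (w ∘P v)) k) ≡ k
  involutive = begin
    lookup (u ∘P (w ∘P v)) (lookup (u ∘P (w ∘P v)) k)  ≡⟨ trans (conj _) (cong (U ∘ W ∘ V) (conj k)) ⟩
    U (W (V (U (W (V k)))))                            ≡⟨ cong (U ∘ W) (vu (W (V k))) ⟩
    U (W (W (V k)))                                    ≡⟨ cong U (proj₁ (w-fpf (V k))) ⟩
    U (V k)                                            ≡⟨ uv k ⟩
    k                                                  ∎
    where open ≡-Reasoning
  fixedPointFree : lookup (u ∘P (w ∘P v)) k ≢ k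
  fixedPointFree e = proj₂ (w-fpf (V k)) (trans (sym (vu _)) (cong V (trans (sym (conj k)) e)))

≤B⇒len≤ : ∀ {n} {a b : Perm n} → a ≤B b → len a ≤ len b
≤B⇒len≤ ε                         = ≤-refl
≤B⇒len≤ (step _ _ _ _ a≤b ◅ b≤c) = ≤-trans a≤b (≤B⇒len≤ b≤c)

private
  indicator-mono : ∀ {p q p′ q′ : Bool} → (T p → T q → T p′ × T q′) →
                   (if p ∧ q then 1 else 0) ≤ (if p′ ∧ q′ then 1 else 0)
  indicator-mono {true}  {true}  {true}  {true}  _ = ≤-refl
  indicator-mono {true}  {true}  {true}  {false} f = ⊥-elim (proj₂ (f _ _))
  indicator-mono {true}  {true}  {false}         f = ⊥-elim (proj₁ (f _ _))
  indicator-mono {true}  {false}                 _ = z≤n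
  indicator-mono {false}                         _ = z≤n

  indicator-true : ∀ {p q : Bool} → T p → T q → (if p ∧ q then 1 else 0) ≡ 1
  indicator-true {true} {true} _ _ = refl

  indicator-false : ∀ {p q : Bool} → ¬ T p → (if p ∧ q then 1 else 0) ≡ 0
  indicator-false {true}  ¬p = ⊥-elim (¬p _)
  indicator-false {false} _  = refl

invPair-mono : ∀ {n} {i j a b i′ j′ a′ b′ : Fin n} →
               (toℕ i < toℕ j → toℕ b < toℕ a → toℕ i′ < toℕ j′ × toℕ b′ < toℕ a′) →
               invPair i j a b ≤ invPair i′ j′ a′ b′
invPair-mono f = indicator-mono λ p q →
  let i′<j′ , b′<a′ = f (<ᵇ⇒< _ _ p) (<ᵇ⇒< _ _ q) in <⇒<ᵇ i′<j′ , <⇒<ᵇ b′<a′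

invPair-inversion : ∀ {n} {i j a b : Fin n} → toℕ i < toℕ j → toℕ b < toℕ a → invPair i j a b ≡ 1
invPair-inversion i<j b<a = indicator-true (<⇒<ᵇ i<j) (<⇒<ᵇ b<a)

invPair-descending : ∀ {n} {i j a b : Fin n} → toℕ j < toℕ i → invPair i j a b ≡ 0
invPair-descending j<i = indicator-false λ p → <-asym j<i (<ᵇ⇒< _ _ p)

sum²-tabulate-involution : ∀ {n} (t : Fin n → Fin n) → (∀ k → t (t k) ≡ k) → (F : Fin n → Fin n → ℕ) →
                           sum (tabulate λ i → sum (tabulate λ j → F i j))
                           ≡ sum (tabulate λ i → sum (tabulate λ j → F (t i) (t j)))
sum²-tabulate-involution t t-inv F =
  trans (cong sum (tabulate-cong λ i → sum-tabulate-involution t t-inv (F i)))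
        (sum-tabulate-involution t t-inv λ i → sum (tabulate λ j → F i (t j)))

len-swapConj : ∀ {n} (a b : Fin n) (w : Perm n) →
  let t = lookup (swap a b); W = lookup w in
  len (swapConj a b w) ≡ sum (tabulate λ i → sum (tabulate λ j → invPair (t i) (t j) (t (W i)) (t (W j))))
len-swapConj a b w = begin
  len (swapConj a b w)
    ≡⟨ cong sum (tabulate-cong λ i → cong sum (tabulate-cong λ j →
         cong₂ (invPair i j) (lookup-swapConj a b w i) (lookup-swapConj a b w j))) ⟩
  sum (tabulate λ i → sum (tabulate λ j → invPair i j (t (W (t i))) (t (W (t j)))))
    ≡⟨ sum²-tabulate-involution t t-inv (λ i j → invPair i j (t (W (t i))) (t (W (t j)))) ⟩
  sum (tabulate λ i → sum (tabulate λ j → invPair (t i) (t j) (t (W (t (t i)))) (t (W (t (t j))))))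
    ≡⟨ cong sum (tabulate-cong λ i → cong sum (tabulate-cong λ j →
         cong₂ (invPair (t i) (t j)) (cong (t ∘ W) (t-inv i)) (cong (t ∘ W) (t-inv j)))) ⟩
  sum (tabulate λ i → sum (tabulate λ j → invPair (t i) (t j) (t (W i)) (t (W j))))
    ∎
  where
  open ≡-Reasoning
  t = lookup (swap a b)
  W = lookup w
  t-inv = lookup-swap-involutive a b

module _ {n} {P Q : Fin n} (adj : toℕ Q ≡ suc (toℕ P)) where

  private
    t = lookup (swap P Q)
    P<Q : toℕ P < toℕ Q
    P<Q = ≤-reflexive (sym adj)
    ≢⇒toℕ≢ : ∀ {a b : Fin n} → a ≢ b → toℕ a ≢ toℕ b
    ≢⇒toℕ≢ a≢b = a≢b ∘ toℕ-injective

  swap-adjacent-preserves-< : ∀ {a b} → toℕ a < toℕ b → ¬ (a ≡ P × b ≡ Q) → toℕ (t a) < toℕ (t b)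
  swap-adjacent-preserves-< {a} {b} a<b ¬PQ with a ≟ P | a ≟ Q | b ≟ P | b ≟ Q
  ... | yes refl | _        | _        | yes refl = ⊥-elim (¬PQ (refl , refl))
  ... | yes refl | _        | yes refl | no  _    = ⊥-elim (<-irrefl refl a<b)
  ... | no  _    | yes refl | yes refl | _        = ⊥-elim (<-asym a<b P<Q)
  ... | no  _    | yes refl | no  _    | yes refl = ⊥-elim (<-irrefl refl a<b)
  ... | yes refl | _        | no  b≢P  | no  b≢Q
    rewrite lookup-swap-left P Q | lookup-swap-other P Q b≢P b≢Q =
    ≤∧≢⇒< (subst (_≤ toℕ b) (sym adj) a<b) (≢⇒toℕ≢ (b≢Q ∘ sym))
  ... | no  _    | yes refl | no  b≢P  | no  b≢Q
    rewrite lookup-swap-right P Q | lookup-swap-other P Q b≢P b≢Q = <-trans P<Q a<b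
  ... | no  a≢P  | no  a≢Q  | yes refl | _
    rewrite lookup-swap-other P Q a≢P a≢Q | lookup-swap-left P Q = <-trans a<b P<Q
  ... | no  a≢P  | no  a≢Q  | no  _    | yes refl
    rewrite lookup-swap-other P Q a≢P a≢Q | lookup-swap-right P Q =
    ≤∧≢⇒< (s≤s⁻¹ (subst (toℕ a <_) adj a<b)) (≢⇒toℕ≢ a≢P)
  ... | no  a≢P  | no  a≢Q  | no  b≢P  | no  b≢Q
    rewrite lookup-swap-other P Q a≢P a≢Q | lookup-swap-other P Q b≢P b≢Q = a<b

  module _ {w : Perm n} (w-fpf : FPF w) where

    private
      W = lookup w
      W-involutive : ∀ k → W (W k) ≡ k
      W-involutive k = proj₁ (w-fpf k)

    swapConj-fixes : W P ≡ Q → swapConj P Q w ≡ w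
    swapConj-fixes WP≡Q = vec-ext λ k → trans (lookup-swapConj P Q w k) (fixes k)
      where
      WQ≡P : W Q ≡ P
      WQ≡P = trans (cong W (sym WP≡Q)) (W-involutive P)
      fixes : ∀ k → t (W (t k)) ≡ W k
      fixes k with k ≟ P | k ≟ Q
      ... | yes refl | _        rewrite lookup-swap-left P Q | WQ≡P = trans (lookup-swap-left P Q) (sym WP≡Q)
      ... | no  _    | yes refl rewrite lookup-swap-right P Q | WP≡Q = trans (lookup-swap-right P Q) (sym WQ≡P)
      ... | no  k≢P  | no  k≢Q  rewrite lookup-swap-other P Q k≢P k≢Q =
        lookup-swap-other P Q (λ Wk≡P → k≢Q (trans (sym (W-involutive k)) (trans (cong W Wk≡P) WP≡Q)))
                              (λ Wk≡Q → k≢P (trans (sym (W-involutive k)) (trans (cong W Wk≡Q) WQ≡P)))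

    -- Conjugating by the adjacent swap keeps every inversion of w and turns the pair (Q, P) into one.
    len<len-swapConj : W P ≢ Q → toℕ (W P) < toℕ (W Q) → len w < len (swapConj P Q w)
    len<len-swapConj WP≢Q WP<WQ = subst (len w <_) (sym (len-swapConj P Q w))
      (sum-tabulate-mono-< (λ i → sum-tabulate-mono-≤ (I≤J i)) Q (sum-tabulate-mono-< (I≤J Q) P IQP<JQP))
      where
      WQ≢P : W Q ≢ P
      WQ≢P WQ≡P = WP≢Q (trans (cong W (sym WQ≡P)) (W-involutive Q))
      I≤J : ∀ i j → invPair i j (W i) (W j) ≤ invPair (t i) (t j) (t (W i)) (t (W j))
      I≤J i j = invPair-mono λ i<j Wj<Wi →
          swap-adjacent-preserves-< i<j (λ { (refl , refl) → <-asym Wj<Wi WP<WQ })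
        , swap-adjacent-preserves-< Wj<Wi λ { (Wj≡P , Wi≡Q) →
            <-asym WP<WQ (subst₂ (λ u v → toℕ u < toℕ v)
              (trans (sym (W-involutive i)) (cong W Wi≡Q)) (trans (sym (W-involutive j)) (cong W Wj≡P)) i<j) }
      IQP<JQP : invPair Q P (W Q) (W P) < invPair (t Q) (t P) (t (W Q)) (t (W P))
      IQP<JQP rewrite invPair-descending {a = W Q} {b = W P} P<Q
                    | lookup-swap-right P Q | lookup-swap-left P Q
                    | lookup-swap-other P Q WQ≢P (proj₂ (w-fpf Q)) | lookup-swap-other P Q (proj₂ (w-fpf P)) WP≢Q
                    | invPair-inversion {a = W Q} {b = W P} P<Q WP<WQ = ≤-refl

  module _ {w : Perm n} (w-fpf : FPF w) where

    private
      W = lookup w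
      y = swapConj P Q w
      y-fpf : FPF y
      y-fpf = FPF-conj {w = w} (swap P Q) (swap P Q) (lookup-swap-involutive P Q) (lookup-swap-involutive P Q) w-fpf
      P≢Q : P ≢ Q
      P≢Q P≡Q = <-irrefl (cong toℕ P≡Q) P<Q
      WP≢WQ : toℕ (W P) ≢ toℕ (W Q)
      WP≢WQ e = P≢Q (trans (sym (proj₁ (w-fpf P))) (trans (cong W (toℕ-injective e)) (proj₁ (w-fpf Q))))

    swapConj≤B⇔ : swapConj P Q w ≤B w ⇔ (toℕ (W Q) < toℕ (W P) ⊎ W P ≡ Q)
    swapConj≤B⇔ = mk⇔ ≤B⇒descent descent⇒≤B
      where
      ≤B⇒descent : y ≤B w → toℕ (W Q) < toℕ (W P) ⊎ W P ≡ Q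
      ≤B⇒descent y≤w with toℕ (W Q) <? toℕ (W P) | W P ≟ Q
      ... | yes WQ<WP | _        = inj₁ WQ<WP
      ... | no  _     | yes WP≡Q = inj₂ WP≡Q
      ... | no  WQ≮WP | no  WP≢Q = ⊥-elim (<-irrefl refl (≤-<-trans (≤B⇒len≤ y≤w) w<y))
        where
        w<y : len w < len y
        w<y = len<len-swapConj {w = w} w-fpf WP≢Q (≤∧≢⇒< (≮⇒≥ WQ≮WP) WP≢WQ)
      descent⇒≤B : toℕ (W Q) < toℕ (W P) ⊎ W P ≡ Q → y ≤B w
      descent⇒≤B (inj₂ WP≡Q) = subst (_≤B w) (sym (swapConj-fixes {w = w} w-fpf WP≡Q)) ε
      descent⇒≤B (inj₁ WQ<WP) with W P ≟ Q
      ... | yes WP≡Q = subst (_≤B w) (sym (swapConj-fixes {w = w} w-fpf WP≡Q)) ε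
      ... | no  WP≢Q = subst (y ≤B_) (swapConj-involutive P Q w)
                         (step P Q y P≢Q (<⇒≤ (len<len-swapConj {w = y} y-fpf yP≢Q yP<yQ)) ◅ ε)
        where
        yP≡WQ : lookup y P ≡ W Q
        yP≡WQ rewrite lookup-swapConj P Q w P | lookup-swap-left P Q =
          lookup-swap-other P Q (λ WQ≡P → WP≢Q (trans (cong W (sym WQ≡P)) (proj₁ (w-fpf Q)))) (proj₂ (w-fpf Q))
        yQ≡WP : lookup y Q ≡ W P
        yQ≡WP rewrite lookup-swapConj P Q w Q | lookup-swap-right P Q =
          lookup-swap-other P Q (proj₂ (w-fpf P)) WP≢Q
        yP≢Q : lookup y P ≢ Q
        yP≢Q yP≡Q = proj₂ (w-fpf Q) (trans (sym yP≡WQ) yP≡Q)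
        yP<yQ : toℕ (lookup y P) < toℕ (lookup y Q)
        yP<yQ = subst₂ (λ u v → toℕ u < toℕ v) (sym yP≡WQ) (sym yQ≡WP) WQ<WP

-- The junk value 0 beyond the end of the vector is never used.
at : ∀ {n l} → Vec (Fin n) l → ℕ → ℕ
at []      _       = 0
at (a ∷ _) zero    = toℕ a
at (_ ∷ v) (suc k) = at v k

at-toℕ : ∀ {n l} (v : Vec (Fin n) l) k → at v (toℕ k) ≡ toℕ (lookup v k)
at-toℕ (a ∷ v) fz     = refl
at-toℕ (a ∷ v) (fs k) = at-toℕ v k

at-fromℕ< : ∀ {n l} (v : Vec (Fin n) l) {k} (k<l : k < l) → at v k ≡ toℕ (lookup v (fromℕ< k<l))
at-fromℕ< v k<l = trans (cong (at v) (sym (toℕ-fromℕ< k<l))) (at-toℕ v (fromℕ< k<l))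

at<n : ∀ {n} (w : Perm n) {k} → k < n → at w k < n
at<n w k<n rewrite at-fromℕ< w k<n = toℕ<n _

at-∘P : ∀ {n} (u v : Perm n) {k} → k < n → at (u ∘P v) k ≡ at u (at v k)
at-∘P u v {k} k<n = begin
  at (u ∘P v) k                         ≡⟨ at-fromℕ< (u ∘P v) k<n ⟩
  toℕ (lookup (u ∘P v) K)               ≡⟨ cong toℕ (lookup-∘P u v K) ⟩
  toℕ (lookup u (lookup v K))           ≡⟨ at-toℕ u (lookup v K) ⟨
  at u (toℕ (lookup v K))               ≡⟨ cong (at u) (at-fromℕ< v k<n) ⟨
  at u (at v k)                         ∎
  where
  open ≡-Reasoning
  K = fromℕ< k<n

at-idP : ∀ {n k} → k < n → at (idP {n}) k ≡ k
at-idP k<n = trans (at-fromℕ< idP k<n) (trans (cong toℕ (lookup-idP _)) (toℕ-fromℕ< k<n))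

module _ {n} (w : Perm n) where

  at-involutive : FPF w → ∀ {k} → k < n → at w (at w k) ≡ k
  at-involutive w-fpf {k} k<n = begin
    at w (at w k)                       ≡⟨ cong (at w) (at-fromℕ< w k<n) ⟩
    at w (toℕ (lookup w K))             ≡⟨ at-toℕ w (lookup w K) ⟩
    toℕ (lookup w (lookup w K))         ≡⟨ cong toℕ (proj₁ (w-fpf K)) ⟩
    toℕ K                               ≡⟨ toℕ-fromℕ< k<n ⟩
    k                                   ∎
    where
    open ≡-Reasoning
    K = fromℕ< k<n

  at-fixedPointFree : FPF w → ∀ {k} → k < n → at w k ≢ k
  at-fixedPointFree w-fpf k<n wk≡k = proj₂ (w-fpf (fromℕ< k<n))
    (toℕ-injective (trans (sym (at-fromℕ< w k<n)) (trans wk≡k (sym (toℕ-fromℕ< k<n)))))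

  at-injective : FPF w → ∀ {a b} → a < n → b < n → at w a ≡ at w b → a ≡ b
  at-injective w-fpf a<n b<n wa≡wb =
    trans (sym (at-involutive w-fpf a<n)) (trans (cong (at w) wa≡wb) (at-involutive w-fpf b<n))

  FPF-from-at : (∀ {k} → k < n → at w (at w k) ≡ k) → (∀ {k} → k < n → at w k ≢ k) → FPF w
  FPF-from-at involutive fixedPointFree K =
      toℕ-injective (trans (sym (at-toℕ w _)) (trans (cong (at w) (sym (at-toℕ w K))) (involutive (toℕ<n K))))
    , λ wK≡K → fixedPointFree (toℕ<n K) (trans (at-toℕ w K) (cong toℕ wK≡K))

module _ {n} (a b : Fin n) where

  at-swap-left : at (swap a b) (toℕ a) ≡ toℕ b
  at-swap-left = trans (at-toℕ (swap a b) a) (cong toℕ (lookup-swap-left a b))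

  at-swap-right : at (swap a b) (toℕ b) ≡ toℕ a
  at-swap-right = trans (at-toℕ (swap a b) b) (cong toℕ (lookup-swap-right a b))

  at-swap-other : ∀ {k} → k < n → k ≢ toℕ a → k ≢ toℕ b → at (swap a b) k ≡ k
  at-swap-other {k} k<n k≢a k≢b = begin
    at (swap a b) k                ≡⟨ at-fromℕ< (swap a b) k<n ⟩
    toℕ (lookup (swap a b) K)      ≡⟨ cong toℕ (lookup-swap-other a b (k≢a ∘ toℕ-K) (k≢b ∘ toℕ-K)) ⟩
    toℕ K                          ≡⟨ toℕ-fromℕ< k<n ⟩
    k                              ∎
    where
    open ≡-Reasoning
    K = fromℕ< k<n
    toℕ-K : ∀ {R} → K ≡ R → k ≡ toℕ R
    toℕ-K refl = sym (toℕ-fromℕ< k<n)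

sAdj≡swap : ∀ {n p} → suc p < n →
            ∃₂ λ (P Q : Fin n) → sAdj (suc p) ≡ swap P Q × toℕ P ≡ p × toℕ Q ≡ suc p
sAdj≡swap {n} {p} sp<n with suc p <? n
... | yes sp<n′ = _ , _ , refl , toℕ-fromℕ< _ , toℕ-fromℕ< sp<n′
... | no  sp≮n  = ⊥-elim (sp≮n sp<n)

lookup-sAdj-involutive : ∀ {n} i (k : Fin n) → lookup (sAdj {n} i) (lookup (sAdj {n} i) k) ≡ k
lookup-sAdj-involutive         zero    k = trans (lookup-idP _) (lookup-idP k)
lookup-sAdj-involutive {n} (suc i) k with suc i <? n
... | yes _ = lookup-swap-involutive _ _ k
... | no  _ = trans (lookup-idP _) (lookup-idP k)

module _ {n : ℕ} where

  at-sAdj-left : ∀ {p} → suc p < n → at (sAdj {n} (suc p)) p ≡ suc p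
  at-sAdj-left sp<n with sAdj≡swap sp<n
  ... | P , Q , sAdj≡swapPQ , refl , Q≡sp rewrite sAdj≡swapPQ = trans (at-swap-left P Q) Q≡sp

  at-sAdj-right : ∀ {p} → suc p < n → at (sAdj {n} (suc p)) (suc p) ≡ p
  at-sAdj-right sp<n with sAdj≡swap sp<n
  ... | P , Q , sAdj≡swapPQ , refl , Q≡sp rewrite sAdj≡swapPQ =
    subst (λ q → at (swap P Q) q ≡ toℕ P) Q≡sp (at-swap-right P Q)

  at-sAdj-other : ∀ {p k} → suc p < n → k < n → k ≢ p → k ≢ suc p → at (sAdj {n} (suc p)) k ≡ k
  at-sAdj-other sp<n k<n k≢p k≢sp with sAdj≡swap sp<n
  ... | P , Q , sAdj≡swapPQ , refl , Q≡sp rewrite sAdj≡swapPQ =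
    at-swap-other P Q k<n k≢p (k≢sp ∘ flip trans Q≡sp)

-- Descent (at w) p says s_(p+1) ∈ τ(w): positions are 0-indexed.
Descent : (ℕ → ℕ) → ℕ → Set
Descent f p = f (suc p) < f p ⊎ f p ≡ suc p

module _ {n} {w : Perm n} (w-fpf : FPF w) where

  InTau⇔Descent : ∀ {p} → suc p < n → InTau w (suc p) ⇔ Descent (at w) p
  InTau⇔Descent sp<n with sAdj≡swap sp<n
  ... | P , Q , sAdj≡swapPQ , refl , Q≡sP =
    mk⇔ (λ (_ , _ , conj≤w) → descent⇔ .to (conj≤w⇔ .to conj≤w))
        (λ d → s≤s z≤n , sp<n , conj≤w⇔ .from (descent⇔ .from d))
    where
    W = lookup w
    S = sAdj {n} (suc (toℕ P))
    SwapDescent = toℕ (W Q) < toℕ (W P) ⊎ W P ≡ Q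
    conj≤w⇔ : (S ∘P (w ∘P S)) ≤B w ⇔ SwapDescent
    conj≤w⇔ = subst (λ s → (s ∘P (w ∘P s)) ≤B w ⇔ SwapDescent) (sym sAdj≡swapPQ)
                    (swapConj≤B⇔ Q≡sP {w = w} w-fpf)
    atQ : at w (suc (toℕ P)) ≡ toℕ (W Q)
    atQ = trans (cong (at w) (sym Q≡sP)) (at-toℕ w Q)
    descent⇔ : SwapDescent ⇔ Descent (at w) (toℕ P)
    descent⇔ = mk⇔
      (λ { (inj₁ WQ<WP) → inj₁ (subst₂ _<_ (sym atQ) (sym (at-toℕ w P)) WQ<WP)
         ; (inj₂ WP≡Q)  → inj₂ (trans (at-toℕ w P) (trans (cong toℕ WP≡Q) Q≡sP)) })
      (λ { (inj₁ wsP<wP) → inj₁ (subst₂ _<_ atQ (at-toℕ w P) wsP<wP)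
         ; (inj₂ wP≡sP)  → inj₂ (toℕ-injective (trans (sym (at-toℕ w P)) (trans wP≡sP (sym Q≡sP)))) })

TauSub⇔Descent⊆ : ∀ {n} {a b : Perm n} → FPF a → FPF b →
                  TauSub a b ⇔ (∀ p → suc p < n → Descent (at a) p → Descent (at b) p)
TauSub⇔Descent⊆ a-fpf b-fpf = mk⇔
  (λ sub p sp<n → InTau⇔Descent b-fpf sp<n .to ∘ sub (suc p) ∘ InTau⇔Descent a-fpf sp<n .from)
  λ { _ zero (() , _)
    ; ⊆ (suc p) τa@(_ , sp<n , _) →
        InTau⇔Descent b-fpf sp<n .from (⊆ p sp<n (InTau⇔Descent a-fpf sp<n .to τa))
    }

module _ {n : ℕ} where

  at-sigma-zero : ∀ {j} → j < n → at (sigma {n} j) 0 ≡ j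
  at-sigma-zero {zero}  0<n  = at-idP 0<n
  at-sigma-zero {suc j} sj<n = trans (at-∘P (sAdj (suc j)) (sigma j) (≤-<-trans z≤n sj<n))
    (trans (cong (at (sAdj {n} (suc j))) (at-sigma-zero (<-trans (n<1+n j) sj<n))) (at-sAdj-left sj<n))

  at-sigma-above : ∀ {j k} → j < k → k < n → at (sigma {n} j) k ≡ k
  at-sigma-above {zero}      _    k<n = at-idP k<n
  at-sigma-above {suc j} {k} sj<k k<n = trans (at-∘P (sAdj (suc j)) (sigma j) k<n)
    (trans (cong (at (sAdj {n} (suc j))) (at-sigma-above (<-trans (n<1+n j) sj<k) k<n))
      (at-sAdj-other (<-trans sj<k k<n) k<n (>⇒≢ (<-trans (n<1+n j) sj<k)) (>⇒≢ sj<k)))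

  at-sigma-suc : ∀ {j k} → k < j → j < n → at (sigma {n} j) (suc k) ≡ k
  at-sigma-suc {suc j} {k} k<sj sj<n = trans (at-∘P (sAdj (suc j)) (sigma j) (≤-<-trans k<sj sj<n))
    (shift (m≤n⇒m<n∨m≡n (s≤s⁻¹ k<sj)))
    where
    j<n = <-trans (n<1+n j) sj<n
    shift : k < j ⊎ k ≡ j → at (sAdj {n} (suc j)) (at (sigma j) (suc k)) ≡ k
    shift (inj₁ k<j)  = trans (cong (at (sAdj {n} (suc j))) (at-sigma-suc k<j j<n))
                          (at-sAdj-other sj<n (<-trans k<j j<n) (<⇒≢ k<j) (<⇒≢ (<-trans k<j (n<1+n j))))
    shift (inj₂ refl) = trans (cong (at (sAdj {n} (suc j))) (at-sigma-above (n<1+n k) sj<n)) (at-sAdj-right sj<n)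

  at-sigmaInv-self : ∀ {j} → j < n → at (sigmaInv {n} j) j ≡ 0
  at-sigmaInv-self {zero}  0<n  = at-idP 0<n
  at-sigmaInv-self {suc j} sj<n = trans (at-∘P (sigmaInv j) (sAdj (suc j)) sj<n)
    (trans (cong (at (sigmaInv {n} j)) (at-sAdj-right sj<n)) (at-sigmaInv-self (<-trans (n<1+n j) sj<n)))

  at-sigmaInv-above : ∀ {j k} → j < k → k < n → at (sigmaInv {n} j) k ≡ k
  at-sigmaInv-above {zero}      _    k<n = at-idP k<n
  at-sigmaInv-above {suc j} {k} sj<k k<n = trans (at-∘P (sigmaInv j) (sAdj (suc j)) k<n)
    (trans (cong (at (sigmaInv {n} j))
             (at-sAdj-other (<-trans sj<k k<n) k<n (>⇒≢ (<-trans (n<1+n j) sj<k)) (>⇒≢ sj<k)))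
      (at-sigmaInv-above (<-trans (n<1+n j) sj<k) k<n))

  at-sigmaInv-below : ∀ {j k} → k < j → j < n → at (sigmaInv {n} j) k ≡ suc k
  at-sigmaInv-below {suc j} {k} k<sj sj<n = trans (at-∘P (sigmaInv j) (sAdj (suc j)) (<-trans k<sj sj<n))
    (shift (m≤n⇒m<n∨m≡n (s≤s⁻¹ k<sj)))
    where
    j<n = <-trans (n<1+n j) sj<n
    shift : k < j ⊎ k ≡ j → at (sigmaInv {n} j) (at (sAdj {n} (suc j)) k) ≡ suc k
    shift (inj₁ k<j)  = trans (cong (at (sigmaInv {n} j))
                                  (at-sAdj-other sj<n (<-trans k<j j<n) (<⇒≢ k<j) (<⇒≢ (<-trans k<j (n<1+n j)))))
                          (at-sigmaInv-below k<j j<n)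
    shift (inj₂ refl) = trans (cong (at (sigmaInv {n} k)) (at-sAdj-left sj<n)) (at-sigmaInv-above (n<1+n k) sj<n)

  module _ {j} (j<n : j < n) where

    private
      g = at (sigma {n} j)

    at-sigma-suc≤ : ∀ {a} → suc a < n → g (suc a) ≤ suc a
    at-sigma-suc≤ {a} sa<n with a <? j
    ... | yes a<j = ≤-trans (≤-reflexive (at-sigma-suc a<j j<n)) (n≤1+n a)
    ... | no  a≮j = ≤-reflexive (at-sigma-above (s≤s (≮⇒≥ a≮j)) sa<n)

    at-sigma-mono : ∀ {a b} → 1 ≤ a → a < b → b < n → g a < g b
    at-sigma-mono {suc a} {suc b} _ sa<sb sb<n with b <? j
    ... | yes b<j rewrite at-sigma-suc b<j j<n | at-sigma-suc (<-trans (s≤s⁻¹ sa<sb) b<j) j<n = s≤s⁻¹ sa<sb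
    ... | no  b≮j rewrite at-sigma-above (s≤s (≮⇒≥ b≮j)) sb<n =
      ≤-<-trans (at-sigma-suc≤ (<-trans sa<sb sb<n)) sa<sb

    at-sigma-reflects-< : ∀ {a b} → 1 ≤ a → 1 ≤ b → a < n → g a < g b → a < b
    at-sigma-reflects-< {a} {b} 1≤a 1≤b a<n ga<gb with <-cmp a b
    ... | tri< a<b _ _  = a<b
    ... | tri≈ _ refl _ = ⊥-elim (<-irrefl refl ga<gb)
    ... | tri> _ _ b<a  = ⊥-elim (<-asym ga<gb (at-sigma-mono 1≤b b<a a<n))

    at-sigma-injective : ∀ {a b} → 1 ≤ a → 1 ≤ b → a < n → b < n → g a ≡ g b → a ≡ b
    at-sigma-injective {a} {b} 1≤a 1≤b a<n b<n ga≡gb with <-cmp a b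
    ... | tri< a<b _ _ = ⊥-elim (<⇒≢ (at-sigma-mono 1≤a a<b b<n) ga≡gb)
    ... | tri≈ _ a≡b _ = a≡b
    ... | tri> _ _ b<a = ⊥-elim (>⇒≢ (at-sigma-mono 1≤b b<a a<n) ga≡gb)

    at-sigma<⇔≤ : ∀ {a} → 1 ≤ a → a < n → g a < j ⇔ a ≤ j
    at-sigma<⇔≤ {suc a} _ sa<n with a <? j
    ... | yes a<j rewrite at-sigma-suc a<j j<n = mk⇔ (λ _ → a<j) (λ _ → a<j)
    ... | no  a≮j rewrite at-sigma-above (s≤s (≮⇒≥ a≮j)) sa<n =
      mk⇔ (λ sa<j → ⊥-elim (a≮j (<-trans (n<1+n a) sa<j))) (λ sa≤j → ⊥-elim (a≮j sa≤j))

  lookup-sigma-sigmaInv : ∀ j (k : Fin n) → lookup (sigma j) (lookup (sigmaInv j) k) ≡ k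
  lookup-sigma-sigmaInv zero    k = trans (lookup-idP _) (lookup-idP k)
  lookup-sigma-sigmaInv (suc j) k = begin
    lookup (sigma (suc j)) (lookup (sigmaInv (suc j)) k)    ≡⟨ lookup-∘P S′ (sigma j) _ ⟩
    S (lookup (sigma j) (lookup (sigmaInv (suc j)) k))      ≡⟨ cong (S ∘ lookup (sigma j)) (lookup-∘P (sigmaInv j) S′ k) ⟩
    S (lookup (sigma j) (lookup (sigmaInv j) (S k)))        ≡⟨ cong S (lookup-sigma-sigmaInv j (S k)) ⟩
    S (S k)                                                 ≡⟨ lookup-sAdj-involutive (suc j) k ⟩
    k                                                       ∎
    where
    open ≡-Reasoning
    S′ = sAdj {n} (suc j)
    S = lookup S′

  lookup-sigmaInv-sigma : ∀ j (k : Fin n) → lookup (sigmaInv j) (lookup (sigma j) k) ≡ k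
  lookup-sigmaInv-sigma zero    k = trans (lookup-idP _) (lookup-idP k)
  lookup-sigmaInv-sigma (suc j) k = begin
    lookup (sigmaInv (suc j)) (lookup (sigma (suc j)) k)    ≡⟨ lookup-∘P (sigmaInv j) S′ _ ⟩
    lookup (sigmaInv j) (S (lookup (sigma (suc j)) k))      ≡⟨ cong (lookup (sigmaInv j) ∘ S) (lookup-∘P S′ (sigma j) k) ⟩
    lookup (sigmaInv j) (S (S (lookup (sigma j) k)))        ≡⟨ cong (lookup (sigmaInv j)) (lookup-sAdj-involutive (suc j) _) ⟩
    lookup (sigmaInv j) (lookup (sigma j) k)                ≡⟨ lookup-sigmaInv-sigma j k ⟩
    k                                                       ∎
    where
    open ≡-Reasoning
    S′ = sAdj {n} (suc j)
    S = lookup S′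

  FPF-nu : ∀ j (x : Perm n) → FPF x → FPF (nu j x)
  FPF-nu j x = FPF-conj {w = x} (sigma j) (sigmaInv j) (lookup-sigma-sigmaInv j) (lookup-sigmaInv-sigma j)

  at-nu : ∀ j (x : Perm n) {k} → k < n → at (nu j x) k ≡ at (sigma j) (at x (at (sigmaInv j) k))
  at-nu j x k<n = trans (at-∘P (sigma j) (x ∘P sigmaInv j) k<n) (cong (at (sigma j)) (at-∘P x (sigmaInv j) k<n))

module DescentsOfNu {n} {x : Perm n} (x-fpf : FPF x) (x0≡1 : at x 0 ≡ 1) where

  private
    A = at x

  x1≡0 : 0 < n → A 1 ≡ 0
  x1≡0 0<n = trans (cong A (sym x0≡1)) (at-involutive x x-fpf 0<n)

  2≤at : ∀ {k} → 2 ≤ k → k < n → 2 ≤ A k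
  2≤at {k} 2≤k k<n with A k | at-involutive x x-fpf k<n
  ... | zero        | A0≡k = ⊥-elim (<-irrefl (trans (sym x0≡1) A0≡k) 2≤k)
  ... | suc zero    | A1≡k = ⊥-elim (<-irrefl (trans (sym (x1≡0 (<-trans 0<k k<n))) A1≡k) 0<k)
    where 0<k = <-trans z<s 2≤k
  ... | suc (suc _) | _    = s≤s (s≤s z≤n)

  module Nu {j} (1≤j : 1 ≤ j) (j<n : j < n) where

    private
      B = at (nu j x)
      g = at (sigma {n} j)

    B-below : ∀ {k} → k < j → B k ≡ g (A (suc k))
    B-below k<j = trans (at-nu j x (<-trans k<j j<n)) (cong (g ∘ A) (at-sigmaInv-below k<j j<n))

    B-self : B j ≡ 0
    B-self = begin
      B j                            ≡⟨ at-nu j x j<n ⟩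
      g (A (at (sigmaInv {n} j) j))  ≡⟨ cong (g ∘ A) (at-sigmaInv-self j<n) ⟩
      g (A 0)                        ≡⟨ cong g x0≡1 ⟩
      g 1                            ≡⟨ at-sigma-suc 1≤j j<n ⟩
      0                              ∎
      where open ≡-Reasoning

    B-above : ∀ {k} → j < k → k < n → B k ≡ g (A k)
    B-above j<k k<n = trans (at-nu j x k<n) (cong (g ∘ A) (at-sigmaInv-above j<k k<n))

    -- σ_j is increasing on [1, n) and every x-value at a position ≥ 2 lies there,
    -- so conjugation by σ_j carries such descents of x to descents of ν_j x.
    descent-transport : ∀ {p p′} → 2 ≤ p′ → suc p′ < n →
                        B p ≡ g (A p′) → B (suc p) ≡ g (A (suc p′)) → g (suc p′) ≡ suc p →
                        Descent B p ⇔ Descent A p′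
    descent-transport {p} {p′} 2≤p′ sp′<n Bp≡ Bsp≡ gsp′≡sp = mk⇔ B⇒A A⇒B
      where
      p′<n = <-trans (n<1+n p′) sp′<n
      1≤Ap′ = <-trans z<s (2≤at 2≤p′ p′<n)
      1≤Asp′ = <-trans z<s (2≤at (m≤n⇒m≤1+n 2≤p′) sp′<n)
      B⇒A : Descent B p → Descent A p′
      B⇒A (inj₁ Bsp<Bp) =
        inj₁ (at-sigma-reflects-< j<n 1≤Asp′ 1≤Ap′ (at<n x sp′<n) (subst₂ _<_ Bsp≡ Bp≡ Bsp<Bp))
      B⇒A (inj₂ Bp≡sp)  = inj₂ (at-sigma-injective j<n 1≤Ap′ z<s (at<n x p′<n) sp′<n
                           (trans (sym Bp≡) (trans Bp≡sp (sym gsp′≡sp))))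
      A⇒B : Descent A p′ → Descent B p
      A⇒B (inj₁ Asp′<Ap′) =
        inj₁ (subst₂ _<_ (sym Bsp≡) (sym Bp≡) (at-sigma-mono j<n 1≤Asp′ Asp′<Ap′ (at<n x p′<n)))
      A⇒B (inj₂ Ap′≡sp′)  = inj₂ (trans Bp≡ (trans (cong g Ap′≡sp′) gsp′≡sp))

    descent-below : ∀ {p} → 1 ≤ p → suc p < j → Descent B p ⇔ Descent A (suc p)
    descent-below 1≤p sp<j = descent-transport (s≤s 1≤p) (≤-<-trans sp<j j<n)
      (B-below (<-trans (n<1+n _) sp<j)) (B-below sp<j) (at-sigma-suc sp<j j<n)

    descent-above : ∀ {p} → j < p → suc p < n → Descent B p ⇔ Descent A p
    descent-above j<p sp<n = descent-transport (≤-<-trans 1≤j j<p) sp<n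
      (B-above j<p (<-trans (n<1+n _) sp<n)) (B-above (<-trans j<p (n<1+n _)) sp<n)
      (at-sigma-above (<-trans j<p (n<1+n _)) sp<n)

    descent-zero : 2 ≤ j → Descent B 0 ⇔ A 2 ≤ j
    descent-zero 2≤j = mk⇔ ⇒A2≤j A2≤j⇒
      where
      B0≡j : B 0 ≡ j
      B0≡j = trans (B-below (<-trans z<s 2≤j)) (trans (cong g (x1≡0 (≤-<-trans z≤n j<n))) (at-sigma-zero j<n))
      B1≡ : B 1 ≡ g (A 2)
      B1≡ = B-below 2≤j
      2<n = ≤-<-trans 2≤j j<n
      g<j⇔ = at-sigma<⇔≤ j<n (<-trans z<s (2≤at ≤-refl 2<n)) (at<n x 2<n)
      ⇒A2≤j : Descent B 0 → A 2 ≤ j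
      ⇒A2≤j (inj₁ B1<B0) = g<j⇔ .to (subst₂ _<_ B1≡ B0≡j B1<B0)
      ⇒A2≤j (inj₂ B0≡1)  = ⊥-elim (<-irrefl (sym (trans (sym B0≡j) B0≡1)) 2≤j)
      A2≤j⇒ : A 2 ≤ j → Descent B 0
      A2≤j⇒ A2≤j = inj₁ (subst₂ _<_ (sym B1≡) (sym B0≡j) (g<j⇔ .from A2≤j))

    descent-pred : ∀ {p} → suc p ≡ j → Descent B p
    descent-pred {p} refl = inj₁ (subst (_< B p) (sym B-self) (n≢0⇒n>0 Bp≢0))
      where
      Bp≢0 : B p ≢ 0
      Bp≢0 Bp≡0 = <⇒≢ (n<1+n p)
        (at-injective (nu j x) (FPF-nu j x x-fpf) (<-trans (n<1+n p) j<n) j<n (trans Bp≡0 (sym B-self)))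

    no-descent-self : ¬ Descent B j
    no-descent-self (inj₁ Bsj<Bj) = n≮0 (subst (B (suc j) <_) B-self Bsj<Bj)
    no-descent-self (inj₂ Bj≡sj)  = 0≢1+n (trans (sym B-self) Bj≡sj)

  ¬InTau-two : ¬ InTau x 2
  ¬InTau-two τ@(_ , 2<n , _) with InTau⇔Descent x-fpf 2<n .to τ
  ... | inj₁ A2<A1 = n≮0 (subst (A 2 <_) (x1≡0 (<-trans z<s 2<n)) A2<A1)
  ... | inj₂ A1≡2  = 0≢1+n (trans (sym (x1≡0 (<-trans z<s 2<n))) A1≡2)

  ¬TauSub-nu-one-two : 2 < n → ¬ TauSub (nu 1 x) (nu 2 x)
  ¬TauSub-nu-one-two 2<n sub = at-fixedPointFree x x-fpf 2<n (≤-antisym A2≤2 (2≤at ≤-refl 2<n))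
    where
    module N₁ = Nu ≤-refl (<-trans (n<1+n 1) 2<n)
    module N₂ = Nu (s≤s z≤n) 2<n
    ⊆ = TauSub⇔Descent⊆ (FPF-nu 1 x x-fpf) (FPF-nu 2 x x-fpf) .to sub
    A2≤2 : A 2 ≤ 2
    A2≤2 = N₂.descent-zero ≤-refl .to (⊆ 0 (<-trans (n<1+n 1) 2<n) (N₁.descent-pred refl))

  TauSub-nu-suc⇔ : ∀ {q} → 2 ≤ q → suc q < n →
                   TauSub (nu q x) (nu (suc q) x) ⇔ (InTau x (suc q) × ¬ InTau x (suc (suc q)))
  TauSub-nu-suc⇔ {q@(suc q₀)} 2≤q sq<n = mk⇔ sub⇒ ⇒sub
    where
    module N′ = Nu (s≤s z≤n) (<-trans (n<1+n q) sq<n)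
    module N  = Nu (s≤s z≤n) sq<n
    ⊆⇔ = TauSub⇔Descent⊆ (FPF-nu q x x-fpf) (FPF-nu (suc q) x x-fpf)
    sub⇒ : TauSub (nu q x) (nu (suc q) x) → InTau x (suc q) × ¬ InTau x (suc (suc q))
    sub⇒ sub = InTau⇔Descent x-fpf sq<n .from descent-q , ¬τsq
      where
      ⊆ = ⊆⇔ .to sub
      descent-q : Descent A q
      descent-q = N.descent-below (s≤s⁻¹ 2≤q) (n<1+n q) .to
                    (⊆ q₀ (<-trans (n<1+n q) sq<n) (N′.descent-pred refl))
      ¬τsq : ¬ InTau x (suc (suc q))
      ¬τsq τ@(_ , ssq<n , _) = N.no-descent-self
        (⊆ (suc q) ssq<n (N′.descent-above (n<1+n q) ssq<n .from (InTau⇔Descent x-fpf ssq<n .to τ)))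
    ⇒sub : InTau x (suc q) × ¬ InTau x (suc (suc q)) → TauSub (nu q x) (nu (suc q) x)
    ⇒sub (τq , ¬τsq) = ⊆⇔ .from ⊆
      where
      descent-q = InTau⇔Descent x-fpf sq<n .to τq
      below : ∀ {r} → r < q → Descent (at (nu q x)) r → Descent (at (nu (suc q) x)) r
      below {zero}  _    d′ =
        N.descent-zero (m≤n⇒m≤1+n 2≤q) .from (m≤n⇒m≤1+n (N′.descent-zero 2≤q .to d′))
      below {suc r} sr<q d′ with m≤n⇒m<n∨m≡n sr<q
      ... | inj₁ ssr<q =
        N.descent-below (s≤s z≤n) (<-trans ssr<q (n<1+n q)) .from (N′.descent-below (s≤s z≤n) ssr<q .to d′)
      ... | inj₂ refl  = N.descent-below (s≤s z≤n) (n<1+n q) .from descent-q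
      above : ∀ {r} → q < r → suc r < n → Descent (at (nu q x)) r → Descent (at (nu (suc q) x)) r
      above q<r sr<n d′ with m≤n⇒m<n∨m≡n q<r
      ... | inj₁ sq<r = N.descent-above sq<r sr<n .from (N′.descent-above q<r sr<n .to d′)
      ... | inj₂ refl = ⊥-elim (¬τsq (InTau⇔Descent x-fpf sr<n .from (N′.descent-above q<r sr<n .to d′)))
      ⊆ : ∀ r → suc r < n → Descent (at (nu q x)) r → Descent (at (nu (suc q) x)) r
      ⊆ r sr<n with <-cmp r q
      ... | tri< r<q _ _  = below r<q
      ... | tri≈ _ refl _ = λ _ → N.descent-pred refl
      ... | tri> _ _ q<r  = above q<r sr<n

  TauSub-nu-pred⇔ : ∀ {j} → 2 ≤ j → j < n →
                    TauSub (nu (j ∸ 1) x) (nu j x) ⇔ (InTau x j × ¬ InTau x (suc j))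
  TauSub-nu-pred⇔ {1}                 (s≤s ()) _
  TauSub-nu-pred⇔ {2}                 _   2<n  =
    mk⇔ (⊥-elim ∘ ¬TauSub-nu-one-two 2<n) (⊥-elim ∘ ¬InTau-two ∘ proj₁)
  TauSub-nu-pred⇔ {suc (suc (suc q))} _   sq<n = TauSub-nu-suc⇔ (s≤s (s≤s z≤n)) sq<n

at-++ˡ : ∀ {n l r} (xs : Vec (Fin n) l) (ys : Vec (Fin n) r) {k} → k < l → at (xs ++ ys) k ≡ at xs k
at-++ˡ (_ ∷ xs) ys {zero}  _   = refl
at-++ˡ (_ ∷ xs) ys {suc k} k<l = at-++ˡ xs ys (s≤s⁻¹ k<l)

at-++ʳ : ∀ {n l r} (xs : Vec (Fin n) l) (ys : Vec (Fin n) r) k → at (xs ++ ys) (l + k) ≡ at ys k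
at-++ʳ []       ys k = refl
at-++ʳ (_ ∷ xs) ys k = at-++ʳ xs ys k

at-map-↑ˡ : ∀ {m l} (z : Vec (Fin m) l) k → at (map (_↑ˡ 2) z) k ≡ at z k
at-map-↑ˡ []      _       = refl
at-map-↑ˡ (a ∷ z) zero    = toℕ-↑ˡ a 2
at-map-↑ˡ (_ ∷ z) (suc k) = at-map-↑ˡ z k

at-w0 : ∀ {n k} → k < n → at (w0 {n}) k ≡ n ∸ suc k
at-w0 {n} {k} k<n = begin
  at (w0 {n}) k                  ≡⟨ at-fromℕ< w0 k<n ⟩
  toℕ (lookup w0 (fromℕ< k<n))   ≡⟨ cong toℕ (lookup∘tabulate opposite (fromℕ< k<n)) ⟩
  toℕ (opposite (fromℕ< k<n))    ≡⟨ opposite-prop (fromℕ< k<n) ⟩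
  n ∸ suc (toℕ (fromℕ< k<n))     ≡⟨ cong (λ k → n ∸ suc k) (toℕ-fromℕ< k<n) ⟩
  n ∸ suc k                            ∎
  where open ≡-Reasoning

lookup-w0-involutive : ∀ {n} (k : Fin n) → lookup (w0 {n}) (lookup w0 k) ≡ k
lookup-w0-involutive k rewrite lookup∘tabulate opposite k | lookup∘tabulate opposite (opposite k) =
  opposite-involutive k

module _ {m} (z : Perm m) where

  private
    n≡ : m + 2 ≡ suc (suc m)
    n≡ = +-comm m 2
    sm<n : suc m < m + 2
    sm<n = ≤-reflexive (sym n≡)
    m<n : m < m + 2
    m<n = <-trans (n<1+n m) sm<n
    S = sAdj {m + 2} (suc m)
    W0 = w0 {m + 2}

  at-embed-< : ∀ {k} → k < m → at (embed z) k ≡ at z k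
  at-embed-< {k} k<m = trans (at-++ˡ (map (_↑ˡ 2) z) _ k<m) (at-map-↑ˡ z k)

  at-embed-m : at (embed z) m ≡ m
  at-embed-m = begin
    at (embed z) m         ≡⟨ cong (at (embed z)) (+-identityʳ m) ⟨
    at (embed z) (m + 0)   ≡⟨ at-++ʳ (map (_↑ˡ 2) z) _ 0 ⟩
    toℕ (m ↑ʳ fz)          ≡⟨ toℕ-↑ʳ m fz ⟩
    m + 0                  ≡⟨ +-identityʳ m ⟩
    m                      ∎
    where open ≡-Reasoning

  at-embed-suc-m : at (embed z) (suc m) ≡ suc m
  at-embed-suc-m = begin
    at (embed z) (suc m)   ≡⟨ cong (at (embed z)) (+-comm m 1) ⟨
    at (embed z) (m + 1)   ≡⟨ at-++ʳ (map (_↑ˡ 2) z) _ 1 ⟩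
    toℕ (m ↑ʳ fs fz)       ≡⟨ toℕ-↑ʳ m (fs fz) ⟩
    m + 1                  ≡⟨ +-comm m 1 ⟩
    suc m                  ∎
    where open ≡-Reasoning

  at-rho-zero : at (rho z) 0 ≡ 1
  at-rho-zero = begin
    at (rho z) 0                             ≡⟨ at-∘P W0 (embed z ∘P (S ∘P W0)) 0<n ⟩
    at W0 (at (embed z ∘P (S ∘P W0)) 0)      ≡⟨ cong (at W0) (at-∘P (embed z) (S ∘P W0) 0<n) ⟩
    at W0 (at (embed z) (at (S ∘P W0) 0))    ≡⟨ cong (at W0 ∘ at (embed z)) (at-∘P S W0 0<n) ⟩
    at W0 (at (embed z) (at S (at W0 0)))    ≡⟨ cong (at W0 ∘ at (embed z) ∘ at S) W0-zero ⟩
    at W0 (at (embed z) (at S (suc m)))      ≡⟨ cong (at W0 ∘ at (embed z)) (at-sAdj-right sm<n) ⟩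
    at W0 (at (embed z) m)                   ≡⟨ cong (at W0) at-embed-m ⟩
    at W0 m                                  ≡⟨ at-w0 m<n ⟩
    m + 2 ∸ suc m                            ≡⟨ cong (_∸ suc m) n≡ ⟩
    suc m ∸ m                                ≡⟨ m+n∸n≡m 1 m ⟩
    1                                        ∎
    where
    open ≡-Reasoning
    0<n = <-trans z<s sm<n
    W0-zero : at W0 0 ≡ suc m
    W0-zero = trans (at-w0 0<n) (cong (_∸ 1) n≡)

  private
    -- ρ(z) = w₀ e w₀, with e the involution z ⊔ (m m+1) on m + 2 points.
    e : Perm (m + 2)
    e = embed z ∘P S

    ρ≡w₀ew₀ : W0 ∘P (e ∘P W0) ≡ rho z
    ρ≡w₀ew₀ = cong (W0 ∘P_) (∘P-assoc (embed z) S W0)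

    <m+2⇒ : ∀ {k} → k < m + 2 → k < m ⊎ k ≡ m ⊎ k ≡ suc m
    <m+2⇒ {k} k<n with m≤n⇒m<n∨m≡n (s≤s⁻¹ (subst (k <_) n≡ k<n))
    ... | inj₂ k≡sm = inj₂ (inj₂ k≡sm)
    ... | inj₁ k<sm with m≤n⇒m<n∨m≡n (s≤s⁻¹ k<sm)
    ...   | inj₁ k<m = inj₁ k<m
    ...   | inj₂ k≡m = inj₂ (inj₁ k≡m)

    at-e-< : ∀ {k} → k < m → at e k ≡ at z k
    at-e-< {k} k<m = begin
      at e k                   ≡⟨ at-∘P (embed z) S k<n ⟩
      at (embed z) (at S k)    ≡⟨ cong (at (embed z)) (at-sAdj-other sm<n k<n (<⇒≢ k<m) (<⇒≢ k<sm)) ⟩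
      at (embed z) k           ≡⟨ at-embed-< k<m ⟩
      at z k                   ∎
      where
      open ≡-Reasoning
      k<n = <-trans k<m m<n
      k<sm = <-trans k<m (n<1+n m)

    at-e-m : at e m ≡ suc m
    at-e-m = trans (at-∘P (embed z) S m<n) (trans (cong (at (embed z)) (at-sAdj-left sm<n)) at-embed-suc-m)

    at-e-suc-m : at e (suc m) ≡ m
    at-e-suc-m = trans (at-∘P (embed z) S sm<n) (trans (cong (at (embed z)) (at-sAdj-right sm<n)) at-embed-m)

  FPF-rho : FPF z → FPF (rho z)
  FPF-rho z-fpf = subst FPF ρ≡w₀ew₀ (FPF-conj {w = e} W0 W0 lookup-w0-involutive lookup-w0-involutive e-fpf)
    where
    e-involutive : ∀ {k} → k < m + 2 → at e (at e k) ≡ k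
    e-involutive k<n with <m+2⇒ k<n
    ... | inj₁ k<m         =
      trans (cong (at e) (at-e-< k<m)) (trans (at-e-< (at<n z k<m)) (at-involutive z z-fpf k<m))
    ... | inj₂ (inj₁ refl) = trans (cong (at e) at-e-m) at-e-suc-m
    ... | inj₂ (inj₂ refl) = trans (cong (at e) at-e-suc-m) at-e-m
    e-fixedPointFree : ∀ {k} → k < m + 2 → at e k ≢ k
    e-fixedPointFree k<n with <m+2⇒ k<n
    ... | inj₁ k<m         = at-fixedPointFree z z-fpf k<m ∘ trans (sym (at-e-< k<m))
    ... | inj₂ (inj₁ refl) = >⇒≢ (n<1+n m) ∘ trans (sym at-e-m)
    ... | inj₂ (inj₂ refl) = <⇒≢ (n<1+n m) ∘ trans (sym at-e-suc-m)
    e-fpf : FPF e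
    e-fpf = FPF-from-at e e-involutive e-fixedPointFree

mainTheorem16 : (m : ℕ) → 4 ≤ m + 2 → 2 ∣ (m + 2) → (x : Perm (m + 2)) → InY1 m x →
    ((j : ℕ) → 2 ≤ j → j ≤ m →
      (TauSub (nu (j ∸ 1) x) (nu j x) ⇔ (InTau x j × ¬ InTau x (suc j))))
    × (TauSub (nu m x) (nu (suc m) x) ⇔ InTau x (suc m))
mainTheorem16 m 4≤n _ x (z , z-fpf , refl) =
    (λ j 2≤j j≤m → TauSub-nu-pred⇔ 2≤j (≤-<-trans j≤m (m<m+n m z<s)))
  , drop-no-descent-at-n ⇔-∘ TauSub-nu-pred⇔ 2≤sm sm<n
  where
  open DescentsOfNu {x = rho z} (FPF-rho z z-fpf) (at-rho-zero z)
  n≡ : m + 2 ≡ suc (suc m)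
  n≡ = +-comm m 2
  sm<n : suc m < m + 2
  sm<n = ≤-reflexive (sym n≡)
  2≤sm : 2 ≤ suc m
  2≤sm = m≤n⇒m≤1+n (s≤s⁻¹ (s≤s⁻¹ (subst (4 ≤_) n≡ 4≤n)))
  drop-no-descent-at-n : (InTau x (suc m) × ¬ InTau x (suc (suc m))) ⇔ InTau x (suc m)
  drop-no-descent-at-n = mk⇔ proj₁ λ τ → τ , λ (_ , ssm<n , _) → <-irrefl (sym n≡) ssm<n
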